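{- Let $U$ be a non-empty factor of the Tribonacci word $\mathbf{t}$. Then there exist a factor $u$ of $\mathbf{t}$ and $\delta\in\{ -1,0,1\}$ such that $(|U|_0,|U|_1,|U|_2)=(|u|+\delta,\,|u|_0,\,|u|_1)$. Moreover, if $|U|\ge 3$, then $|u|<|U|$.
   Context: Let $\tau$ be the morphism on $\{0,1,2\}^*$ given by $0\mapsto 01$, $1\mapsto 02$, $2\mapsto 0$, and let $\mathbf{t}=\lim_{n\to\infty}\tau^n(0)=01020100102010\cdots$ be its fixed point. A factor is a finite block of consecutive letters of $\mathbf{t}$; the empty word is allowed as the factor $u$. For a finite word $w$, $|w|$ is its length and $|w|_a$ the number of occurrences of the letter $a$ in $w$. -}

module Defs where

import Data.Bool
open import Data.Nat using (ℕ; zero; suc; _+_)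
open import Data.List using (List; []; _∷_; _++_; concatMap; length; map; upTo; filterᵇ)
open import Data.Product using (Σ)
open import Relation.Binary.PropositionalEquality using (_≡_)

data Letter : Set where
  a0 a1 a2 : Letter

Word : Set
Word = List Letter

τ₁ : Letter → Word
τ₁ a0 = a0 ∷ a1 ∷ []
τ₁ a1 = a0 ∷ a2 ∷ []
τ₁ a2 = a0 ∷ []

τ : Word → Word
τ = concatMap τ₁

τⁿ0 : ℕ → Word
τⁿ0 zero = a0 ∷ []
τⁿ0 (suc n) = τ (τⁿ0 n)

-- letter at index i of a word (default a0 if out of range; never used out of range below)
at : Word → ℕ → Letter
at [] _ = a0
at (x ∷ _) zero = x
at (_ ∷ w) (suc i) = at w i

-- the Tribonacci word t = lim τ^n(0), as a function ℕ → Letter (0-indexed).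
-- τ^(n+1)(0) has length ≥ n+1 and is a prefix of t, so this is its n-th letter.
t : ℕ → Letter
t n = at (τⁿ0 (suc n)) n

block : ℕ → ℕ → Word
block i m = map (λ j → t (i + j)) (upTo m)

Factor : Word → Set
Factor w = Σ ℕ (λ i → w ≡ block i (length w))

isA : Letter → Letter → Data.Bool.Bool
isA a0 a0 = Data.Bool.true
isA a1 a1 = Data.Bool.true
isA a2 a2 = Data.Bool.true
isA _ _ = Data.Bool.false

count : Letter → Word → ℕ
count a w = length (filterᵇ (isA a) w)

-- Cut a factor U of t out of some τ(W), W = τⁿ(0). A cut falls either between the images τ(a) or
-- inside τ(0) = 01 or τ(1) = 02, so U = [c] τ(A) [0] where the optional c ∈ {1,2} is the tail of the
-- image of the letter d = c − 1 just before A, and u = [d] A is again a factor. As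
-- |τA|₀ = |A|, |τA|₁ = |A|₀ and |τA|₂ = |A|₁, the Parikh vector of U is that of u shifted, with δ
-- recording the boundary letters. Finally |τA| = |A| + |A|₀ + |A|₁ exceeds |A| once A contains a 0 or
-- a 1, which happens as soon as |A| ≥ 2 because 22 is not a factor of t.
module Submission where

open import Defs
open import Data.Nat using (ℕ; _≥_; _<_)
open import Data.Integer using (ℤ; +_; _+_; -_)
open import Data.List using (List; []; _∷_; length)
open import Data.Product using (Σ; _×_; ∃-syntax)
open import Data.Sum using (_⊎_)
open import Relation.Nullary using (¬_)
open import Relation.Binary.PropositionalEquality using (_≡_)

import Data.Nat as ℕ
open import Data.Nat using (zero; suc; _≤_; _∸_; z≤n; s≤s; _≤′_; ≤′-reflexive; ≤′-step)
open import Data.Nat.Properties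
  using (≤-trans; ≤-total; ≤⇒≤′; <-≤-trans; ≤-<-trans; n≤1+n; <⇒≤; m≤m+n; m≤n+m; m<m+n; ≰⇒>; _≤?_;
         +-suc; +-assoc; module ≤-Reasoning; +-identityʳ; suc-injective; m+[n∸m]≡n)
open import Data.Integer using (_-_)
open import Data.Integer.Tactic.RingSolver using (solve-∀)
import Data.Integer.Properties as ℤ
open import Data.List using (_++_; applyUpTo; upTo; filterᵇ)
open import Data.List.Properties
  using (∷-injectiveˡ; ∷-injectiveʳ; length-++; ++-assoc; ++-identityʳ; length-map; length-upTo;
         map-upTo; concatMap-++; filter-++)
open import Data.Bool using (T?)
open import Data.Product using (_,_; proj₁; proj₂)
open import Data.Sum using (inj₁; inj₂)
open import Data.Empty using (⊥-elim)
open import Function using (_∘_)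
open import Relation.Nullary using (yes; no)
open import Relation.Binary.PropositionalEquality using (refl; sym; trans; cong; cong₂; subst; module ≡-Reasoning)

τ-++ : ∀ v w → τ (v ++ w) ≡ τ v ++ τ w
τ-++ = concatMap-++ τ₁

count-++ : ∀ a v w → count a (v ++ w) ≡ count a v ℕ.+ count a w
count-++ a v w = trans (cong length (filter-++ (T? ∘ isA a) v w)) (length-++ (filterᵇ (isA a) v))

count₀-τ : ∀ w → count a0 (τ w) ≡ length w
count₀-τ [] = refl
count₀-τ (a0 ∷ w) = cong suc (count₀-τ w)
count₀-τ (a1 ∷ w) = cong suc (count₀-τ w)
count₀-τ (a2 ∷ w) = cong suc (count₀-τ w)

count₁-τ : ∀ w → count a1 (τ w) ≡ count a0 w
count₁-τ [] = refl
count₁-τ (a0 ∷ w) = cong suc (count₁-τ w)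
count₁-τ (a1 ∷ w) = count₁-τ w
count₁-τ (a2 ∷ w) = count₁-τ w

count₂-τ : ∀ w → count a2 (τ w) ≡ count a1 w
count₂-τ [] = refl
count₂-τ (a0 ∷ w) = count₂-τ w
count₂-τ (a1 ∷ w) = cong suc (count₂-τ w)
count₂-τ (a2 ∷ w) = count₂-τ w

length-τ : ∀ w → length (τ w) ≡ length w ℕ.+ (count a0 w ℕ.+ count a1 w)
length-τ [] = refl
length-τ (a0 ∷ w) = cong suc (trans (cong suc (length-τ w)) (sym (+-suc (length w) _)))
length-τ (a1 ∷ w) = cong suc (begin
  suc (length (τ w))                                 ≡⟨ cong suc (length-τ w) ⟩
  suc (length w ℕ.+ (count a0 w ℕ.+ count a1 w))     ≡⟨ +-suc (length w) _ ⟨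
  length w ℕ.+ suc (count a0 w ℕ.+ count a1 w)       ≡⟨ cong (length w ℕ.+_) (+-suc (count a0 w) _) ⟨
  length w ℕ.+ (count a0 w ℕ.+ suc (count a1 w))     ∎)
  where open ≡-Reasoning
length-τ (a2 ∷ w) = cong suc (length-τ w)

length≤length-τ : ∀ w → length w ≤ length (τ w)
length≤length-τ w = subst (length w ≤_) (sym (length-τ w)) (m≤m+n _ _)

data Has22 : Word → Set where
  here  : ∀ {w} → Has22 (a2 ∷ a2 ∷ w)
  there : ∀ {a w} → Has22 w → Has22 (a ∷ w)

Has22-++ˡ : ∀ {v} w → Has22 v → Has22 (v ++ w)
Has22-++ˡ w here = here
Has22-++ˡ w (there h) = there (Has22-++ˡ w h)

Has22-∷τ : ∀ {a} w → Has22 (a ∷ τ w) → Has22 (τ w)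
Has22-∷τ [] (there ())
Has22-∷τ (a0 ∷ _) (there h) = h
Has22-∷τ (a1 ∷ _) (there h) = h
Has22-∷τ (a2 ∷ _) (there h) = h

¬Has22-τ : ∀ w → ¬ Has22 (τ w)
¬Has22-τ [] ()
¬Has22-τ (a0 ∷ w) (there (there h)) = ¬Has22-τ w h
¬Has22-τ (a1 ∷ w) (there h) = ¬Has22-τ w (Has22-∷τ w h)
¬Has22-τ (a2 ∷ w) (there h) = ¬Has22-τ w h

¬Has22-τⁿ0 : ∀ n → ¬ Has22 (τⁿ0 n)
¬Has22-τⁿ0 zero (there ())
¬Has22-τⁿ0 (suc n) = ¬Has22-τ (τⁿ0 n)

¬Has22⇒count₀+count₁>0 : ∀ w → ¬ Has22 w → 2 ≤ length w → 0 < count a0 w ℕ.+ count a1 w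
¬Has22⇒count₀+count₁>0 (a0 ∷ w) _ _ = s≤s z≤n
¬Has22⇒count₀+count₁>0 (a1 ∷ w) _ _ = ≤-trans (s≤s z≤n) (m≤n+m (suc (count a1 w)) (count a0 w))
¬Has22⇒count₀+count₁>0 (a2 ∷ a0 ∷ w) _ _ = s≤s z≤n
¬Has22⇒count₀+count₁>0 (a2 ∷ a1 ∷ w) _ _ = ≤-trans (s≤s z≤n) (m≤n+m (suc (count a1 w)) (count a0 w))
¬Has22⇒count₀+count₁>0 (a2 ∷ a2 ∷ w) nf _ = ⊥-elim (nf here)
¬Has22⇒count₀+count₁>0 (a2 ∷ []) _ (s≤s ())

length<length-τ : ∀ w → ¬ Has22 w → 2 ≤ length (τ w) → length w < length (τ w)
length<length-τ w nf 2≤∣τw∣ with 2 ≤? length w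
... | yes 2≤∣w∣ = subst (length w <_) (sym (length-τ w)) (m<m+n (length w) (¬Has22⇒count₀+count₁>0 w nf 2≤∣w∣))
... | no 2≰∣w∣ = <-≤-trans (≰⇒> 2≰∣w∣) 2≤∣τw∣

τ₁-head : ∀ a → ∃[ r ] (τ₁ a ≡ a0 ∷ r)
τ₁-head a0 = a1 ∷ [] , refl
τ₁-head a1 = a2 ∷ [] , refl
τ₁-head a2 = [] , refl

τⁿ0-extends : ∀ n → ∃[ a ] ∃[ z ] (τⁿ0 (suc n) ≡ τⁿ0 n ++ a ∷ z)
τⁿ0-extends zero = a1 , [] , refl
τⁿ0-extends (suc n) with τⁿ0-extends n
... | a , z , eq with τ₁-head a
...   | r , eqa = a0 , r ++ τ z , (begin
  τ (τⁿ0 (suc n))                  ≡⟨ cong τ eq ⟩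
  τ (τⁿ0 n ++ a ∷ z)               ≡⟨ τ-++ (τⁿ0 n) (a ∷ z) ⟩
  τⁿ0 (suc n) ++ τ₁ a ++ τ z       ≡⟨ cong (λ v → τⁿ0 (suc n) ++ v ++ τ z) eqa ⟩
  τⁿ0 (suc n) ++ a0 ∷ r ++ τ z     ∎)
  where open ≡-Reasoning

τⁿ0-prefix : ∀ {m n} → m ≤′ n → ∃[ z ] (τⁿ0 n ≡ τⁿ0 m ++ z)
τⁿ0-prefix {m} (≤′-reflexive refl) = [] , sym (++-identityʳ (τⁿ0 m))
τⁿ0-prefix {m} (≤′-step {n} m≤′n) with τⁿ0-prefix m≤′n | τⁿ0-extends n
... | z , eq | a , z′ , eq′ = z ++ a ∷ z′ , (begin
  τⁿ0 (suc n)              ≡⟨ eq′ ⟩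
  τⁿ0 n ++ a ∷ z′          ≡⟨ cong (_++ a ∷ z′) eq ⟩
  (τⁿ0 m ++ z) ++ a ∷ z′   ≡⟨ ++-assoc (τⁿ0 m) z (a ∷ z′) ⟩
  τⁿ0 m ++ z ++ a ∷ z′     ∎)
  where open ≡-Reasoning

n<length-τⁿ0 : ∀ n → n < length (τⁿ0 n)
n<length-τⁿ0 zero = s≤s z≤n
n<length-τⁿ0 (suc n) with τⁿ0-extends n
... | a , z , eq = begin-strict
  suc n                                 ≤⟨ n<length-τⁿ0 n ⟩
  length (τⁿ0 n)                        <⟨ m<m+n (length (τⁿ0 n)) (s≤s z≤n) ⟩
  length (τⁿ0 n) ℕ.+ length (a ∷ z)    ≡⟨ length-++ (τⁿ0 n) ⟨
  length (τⁿ0 n ++ a ∷ z)               ≡⟨ cong length eq ⟨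
  length (τⁿ0 (suc n))                  ∎
  where open ≤-Reasoning

at-++ˡ : ∀ v w {j} → j < length v → at (v ++ w) j ≡ at v j
at-++ˡ (_ ∷ _) w {zero} _ = refl
at-++ˡ (_ ∷ v) w {suc j} (s≤s j<∣v∣) = at-++ˡ v w j<∣v∣

at-τⁿ0-stable : ∀ {m n j} → m ≤ n → j < length (τⁿ0 m) → at (τⁿ0 n) j ≡ at (τⁿ0 m) j
at-τⁿ0-stable {m} {n} {j} m≤n j<∣τⁿ0m∣ with τⁿ0-prefix (≤⇒≤′ m≤n)
... | z , eq = trans (cong (λ w → at w j) eq) (at-++ˡ (τⁿ0 m) z j<∣τⁿ0m∣)

at-τⁿ0 : ∀ n {j} → j < length (τⁿ0 n) → at (τⁿ0 n) j ≡ t j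
at-τⁿ0 n {j} j<∣τⁿ0n∣ with ≤-total n (suc j)
... | inj₁ n≤1+j = sym (at-τⁿ0-stable n≤1+j j<∣τⁿ0n∣)
... | inj₂ 1+j≤n = at-τⁿ0-stable 1+j≤n (≤-trans (n≤1+n _) (n<length-τⁿ0 (suc j)))

applyUpTo-at : ∀ w → applyUpTo (at w) (length w) ≡ w
applyUpTo-at [] = refl
applyUpTo-at (a ∷ w) = cong (a ∷_) (applyUpTo-at w)

applyUpTo-cong : ∀ {A : Set} {f g : ℕ → A} n → (∀ {j} → j < n → f j ≡ g j) → applyUpTo f n ≡ applyUpTo g n
applyUpTo-cong zero _ = refl
applyUpTo-cong (suc n) f≗g = cong₂ _∷_ (f≗g (s≤s z≤n)) (applyUpTo-cong n (f≗g ∘ s≤s))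

applyUpTo-+ : ∀ {A : Set} (f : ℕ → A) m n → applyUpTo f (m ℕ.+ n) ≡ applyUpTo f m ++ applyUpTo (λ j → f (m ℕ.+ j)) n
applyUpTo-+ f zero n = refl
applyUpTo-+ f (suc m) n = cong (f 0 ∷_) (applyUpTo-+ (f ∘ suc) m n)

block-applyUpTo : ∀ i m → block i m ≡ applyUpTo (λ j → t (i ℕ.+ j)) m
block-applyUpTo i = map-upTo (λ j → t (i ℕ.+ j))

length-block : ∀ i m → length (block i m) ≡ m
length-block i m = trans (length-map _ (upTo m)) (length-upTo m)

block-+ : ∀ i m n → block i (m ℕ.+ n) ≡ block i m ++ block (i ℕ.+ m) n
block-+ i m n = begin
  block i (m ℕ.+ n)                                                       ≡⟨ block-applyUpTo i (m ℕ.+ n) ⟩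
  applyUpTo (λ j → t (i ℕ.+ j)) (m ℕ.+ n)                                 ≡⟨ applyUpTo-+ _ m n ⟩
  applyUpTo (λ j → t (i ℕ.+ j)) m ++ applyUpTo (λ j → t (i ℕ.+ (m ℕ.+ j))) n
    ≡⟨ cong₂ _++_ (sym (block-applyUpTo i m))
         (applyUpTo-cong n (λ {j} _ → cong t (sym (+-assoc i m j)))) ⟩
  block i m ++ applyUpTo (λ j → t (i ℕ.+ m ℕ.+ j)) n                      ≡⟨ cong (block i m ++_) (block-applyUpTo (i ℕ.+ m) n) ⟨
  block i m ++ block (i ℕ.+ m) n                                          ∎
  where open ≡-Reasoning

τⁿ0-block : ∀ n → τⁿ0 n ≡ block 0 (length (τⁿ0 n))
τⁿ0-block n = begin
  τⁿ0 n                                  ≡⟨ applyUpTo-at (τⁿ0 n) ⟨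
  applyUpTo (at (τⁿ0 n)) (length (τⁿ0 n)) ≡⟨ applyUpTo-cong (length (τⁿ0 n)) (at-τⁿ0 n) ⟩
  applyUpTo t (length (τⁿ0 n))            ≡⟨ block-applyUpTo 0 (length (τⁿ0 n)) ⟨
  block 0 (length (τⁿ0 n))                ∎
  where open ≡-Reasoning

++-injective : ∀ {A : Set} (v v′ : List A) {w w′ : List A} → length v ≡ length v′ → v ++ w ≡ v′ ++ w′ → v ≡ v′ × w ≡ w′
++-injective [] [] _ eq = refl , eq
++-injective (_ ∷ v) (_ ∷ v′) ∣v∣≡∣v′∣ eq with ++-injective v v′ (suc-injective ∣v∣≡∣v′∣) (∷-injectiveʳ eq)
... | refl , w≡w′ = cong (_∷ v) (∷-injectiveˡ eq) , w≡w′

Infix : Word → Word → Set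
Infix v w = ∃[ x ] ∃[ y ] (w ≡ x ++ v ++ y)

infix⇒factor : ∀ n {u} → Infix u (τⁿ0 n) → Factor u
infix⇒factor n {u} (x , y , eq) = length x , u≡block
  where
  open ≡-Reasoning
  ∣x∣ ∣u∣ : ℕ
  ∣x∣ = length x
  ∣u∣ = length u
  split : x ++ u ++ y ≡ block 0 ∣x∣ ++ block ∣x∣ ∣u∣ ++ block (∣x∣ ℕ.+ ∣u∣) (length y)
  split = begin
    x ++ u ++ y                                                    ≡⟨ eq ⟨
    τⁿ0 n                                                          ≡⟨ τⁿ0-block n ⟩
    block 0 (length (τⁿ0 n))                                       ≡⟨ cong (block 0 ∘ length) eq ⟩
    block 0 (length (x ++ u ++ y))                                 ≡⟨ cong (block 0) (trans (length-++ x) (cong (∣x∣ ℕ.+_) (length-++ u))) ⟩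
    block 0 (∣x∣ ℕ.+ (∣u∣ ℕ.+ length y))                           ≡⟨ block-+ 0 ∣x∣ (∣u∣ ℕ.+ length y) ⟩
    block 0 ∣x∣ ++ block ∣x∣ (∣u∣ ℕ.+ length y)                    ≡⟨ cong (block 0 ∣x∣ ++_) (block-+ ∣x∣ ∣u∣ (length y)) ⟩
    block 0 ∣x∣ ++ block ∣x∣ ∣u∣ ++ block (∣x∣ ℕ.+ ∣u∣) (length y) ∎
  u≡block : u ≡ block ∣x∣ ∣u∣
  u≡block = proj₁ (++-injective u (block ∣x∣ ∣u∣) (sym (length-block ∣x∣ ∣u∣))
              (proj₂ (++-injective x (block 0 ∣x∣) (sym (length-block 0 ∣x∣)) split)))

factor⇒infix : ∀ {U} → Factor U → ∃[ n ] Infix U (τ (τⁿ0 n))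
factor⇒infix {U} (i , U≡block) = n , block 0 i , block (i ℕ.+ m) k , (begin
  τⁿ0 (suc n)                                 ≡⟨ τⁿ0-block (suc n) ⟩
  block 0 (length (τⁿ0 (suc n)))              ≡⟨ cong (block 0) (m+[n∸m]≡n n≤∣τⁿ0∣) ⟨
  block 0 (n ℕ.+ k)                           ≡⟨ cong (block 0) (+-assoc i m k) ⟩
  block 0 (i ℕ.+ (m ℕ.+ k))                   ≡⟨ block-+ 0 i (m ℕ.+ k) ⟩
  block 0 i ++ block i (m ℕ.+ k)              ≡⟨ cong (block 0 i ++_) (block-+ i m k) ⟩
  block 0 i ++ block i m ++ block (i ℕ.+ m) k ≡⟨ cong (λ v → block 0 i ++ v ++ block (i ℕ.+ m) k) U≡block ⟨
  block 0 i ++ U ++ block (i ℕ.+ m) k         ∎)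
  where
  open ≡-Reasoning
  m n k : ℕ
  m = length U
  n = i ℕ.+ m
  k = length (τⁿ0 (suc n)) ∸ n
  n≤∣τⁿ0∣ : n ≤ length (τⁿ0 (suc n))
  n≤∣τⁿ0∣ = ≤-trans (n≤1+n n) (<⇒≤ (n<length-τⁿ0 (suc n)))

record ShiftedParikh (U u : Word) (δ : ℤ) : Set where
  field
    count₀ : + count a0 U ≡ + length u + δ
    count₁ : count a1 U ≡ count a0 u
    count₂ : count a2 U ≡ count a1 u

-- Next d c  iff  τ₁ d ≡ a0 ∷ c ∷ []; a cut inside τ₁ d leaves c.
data Next : Letter → Letter → Set where
  next₀ : Next a0 a1
  next₁ : Next a1 a2

shiftedParikh-τ : ∀ w → ShiftedParikh (τ w) w (+ 0)
shiftedParikh-τ w = record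
  { count₀ = cong +_ (trans (count₀-τ w) (sym (+-identityʳ (length w))))
  ; count₁ = count₁-τ w
  ; count₂ = count₂-τ w
  }

shiftedParikh-∷ʳ0 : ∀ {U u δ} → ShiftedParikh U u δ → ShiftedParikh (U ++ a0 ∷ []) u (δ + + 1)
shiftedParikh-∷ʳ0 {U} {u} {δ} s = record
  { count₀ = begin
      + count a0 (U ++ a0 ∷ [])     ≡⟨ cong +_ (count-++ a0 U (a0 ∷ [])) ⟩
      + count a0 U + + 1            ≡⟨ cong (_+ + 1) count₀ ⟩
      + length u + δ + + 1          ≡⟨ ℤ.+-assoc (+ length u) δ (+ 1) ⟩
      + length u + (δ + + 1)        ∎
  ; count₁ = trans (count-++ a1 U (a0 ∷ [])) (trans (+-identityʳ _) count₁)
  ; count₂ = trans (count-++ a2 U (a0 ∷ [])) (trans (+-identityʳ _) count₂)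
  }
  where
  open ShiftedParikh s
  open ≡-Reasoning

m+n≡[1+m]+[n-1] : ∀ (m n : ℤ) → m + n ≡ (+ 1 + m) + (n - + 1)
m+n≡[1+m]+[n-1] = solve-∀

shiftedParikh-∷ : ∀ {d c U u δ} → Next d c → ShiftedParikh U u δ → ShiftedParikh (c ∷ U) (d ∷ u) (δ - + 1)
shiftedParikh-∷ {u = u} {δ} next₀ s = record
  { count₀ = trans count₀ (m+n≡[1+m]+[n-1] (+ length u) δ)
  ; count₁ = cong suc count₁
  ; count₂ = count₂
  }
  where open ShiftedParikh s
shiftedParikh-∷ {u = u} {δ} next₁ s = record
  { count₀ = trans count₀ (m+n≡[1+m]+[n-1] (+ length u) δ)
  ; count₁ = count₁
  ; count₂ = cong suc count₂
  }
  where open ShiftedParikh s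

data ImageSuffix : Word → Word → Set where
  boundary : ∀ V → ImageSuffix V (τ V)
  inside   : ∀ {d c} V → Next d c → ImageSuffix (d ∷ V) (c ∷ τ V)
  skip     : ∀ {W R} a → ImageSuffix W R → ImageSuffix (a ∷ W) R

suffix-τ : ∀ W x {R} → τ W ≡ x ++ R → ImageSuffix W R
suffix-τ W [] eq = subst (ImageSuffix W) eq (boundary W)
suffix-τ [] (_ ∷ _) ()
suffix-τ (a0 ∷ W) (_ ∷ []) eq = subst (ImageSuffix (a0 ∷ W)) (∷-injectiveʳ eq) (inside W next₀)
suffix-τ (a1 ∷ W) (_ ∷ []) eq = subst (ImageSuffix (a1 ∷ W)) (∷-injectiveʳ eq) (inside W next₁)
suffix-τ (a0 ∷ W) (_ ∷ _ ∷ x) eq = skip a0 (suffix-τ W x (∷-injectiveʳ (∷-injectiveʳ eq)))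
suffix-τ (a1 ∷ W) (_ ∷ _ ∷ x) eq = skip a1 (suffix-τ W x (∷-injectiveʳ (∷-injectiveʳ eq)))
suffix-τ (a2 ∷ W) (_ ∷ x) eq = skip a2 (suffix-τ W x (∷-injectiveʳ eq))

data ImagePrefix : Word → Word → Set where
  exact : ∀ A → ImagePrefix A (τ A)
  with0 : ∀ A → ImagePrefix A (τ A ++ a0 ∷ [])

ImagePrefixOf : Word → Word → Set
ImagePrefixOf W U = ∃[ A ] ∃[ B ] (W ≡ A ++ B × ImagePrefix A U)

imagePrefixOf-∷ : ∀ a {W U} → ImagePrefixOf W U → ImagePrefixOf (a ∷ W) (τ₁ a ++ U)
imagePrefixOf-∷ a (A , B , refl , exact A) = a ∷ A , B , refl , exact (a ∷ A)
imagePrefixOf-∷ a (A , B , refl , with0 A) =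
  a ∷ A , B , refl , subst (ImagePrefix (a ∷ A)) (++-assoc (τ₁ a) (τ A) (a0 ∷ [])) (with0 (a ∷ A))

prefix-τ : ∀ W U {y} → τ W ≡ U ++ y → ImagePrefixOf W U
prefix-τ W [] _ = [] , W , refl , exact []
prefix-τ [] (_ ∷ _) ()
prefix-τ (a2 ∷ W) (_ ∷ U) eq with ∷-injectiveˡ eq
... | refl = imagePrefixOf-∷ a2 (prefix-τ W U (∷-injectiveʳ eq))
prefix-τ (a0 ∷ W) (_ ∷ []) eq with ∷-injectiveˡ eq
... | refl = [] , a0 ∷ W , refl , with0 []
prefix-τ (a1 ∷ W) (_ ∷ []) eq with ∷-injectiveˡ eq
... | refl = [] , a1 ∷ W , refl , with0 []
prefix-τ (a0 ∷ W) (_ ∷ _ ∷ U) eq with ∷-injectiveˡ eq | ∷-injectiveˡ (∷-injectiveʳ eq)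
... | refl | refl = imagePrefixOf-∷ a0 (prefix-τ W U (∷-injectiveʳ (∷-injectiveʳ eq)))
prefix-τ (a1 ∷ W) (_ ∷ _ ∷ U) eq with ∷-injectiveˡ eq | ∷-injectiveˡ (∷-injectiveʳ eq)
... | refl | refl = imagePrefixOf-∷ a1 (prefix-τ W U (∷-injectiveʳ (∷-injectiveʳ eq)))

length<length-τ∷ʳ0 : ∀ w → length w < length (τ w ++ a0 ∷ [])
length<length-τ∷ʳ0 w = ≤-<-trans (length≤length-τ w)
  (subst (length (τ w) <_) (sym (length-++ (τ w))) (m<m+n (length (τ w)) (s≤s z≤n)))

Antecedent : Word → Word → Set
Antecedent u U = ∃[ δ ] ((δ ≡ - (+ 1) ⊎ δ ≡ + 0 ⊎ δ ≡ + 1) × ShiftedParikh U u δ × (length U ≥ 3 → length u < length U))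

antecedent-prefix : ∀ {A U} → ¬ Has22 A → ImagePrefix A U → Antecedent A U
antecedent-prefix nf (exact A) =
  + 0 , inj₂ (inj₁ refl) , shiftedParikh-τ A , λ 3≤∣U∣ → length<length-τ A nf (≤-trans (n≤1+n 2) 3≤∣U∣)
antecedent-prefix nf (with0 A) =
  + 1 , inj₂ (inj₂ refl) , shiftedParikh-∷ʳ0 (shiftedParikh-τ A) , λ _ → length<length-τ∷ʳ0 A

antecedent-cut : ∀ {d c A U} → Next d c → ¬ Has22 A → ImagePrefix A U → Antecedent (d ∷ A) (c ∷ U)
antecedent-cut next nf (exact A) =
  - (+ 1) , inj₁ refl , shiftedParikh-∷ next (shiftedParikh-τ A) , λ { (s≤s 2≤∣τA∣) → s≤s (length<length-τ A nf 2≤∣τA∣) }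
antecedent-cut next nf (with0 A) =
  + 0 , inj₂ (inj₁ refl) , shiftedParikh-∷ next (shiftedParikh-∷ʳ0 (shiftedParikh-τ A)) , λ _ → s≤s (length<length-τ∷ʳ0 A)

desubstitute : ∀ {W R U y} → ImageSuffix W R → R ≡ U ++ y → ¬ U ≡ [] → ¬ Has22 W → ∃[ u ] (Infix u W × Antecedent u U)
desubstitute (boundary V) eq _ nf with prefix-τ V _ eq
... | A , B , refl , p = A , ([] , B , refl) , antecedent-prefix (nf ∘ Has22-++ˡ B) p
desubstitute {U = []} (inside V next) _ U≢[] _ = ⊥-elim (U≢[] refl)
desubstitute {U = _ ∷ U} (inside V next) eq _ nf with ∷-injectiveˡ eq | prefix-τ V U (∷-injectiveʳ eq)
... | refl | A , B , refl , p = _ ∷ A , ([] , B , refl) , antecedent-cut next (nf ∘ there ∘ Has22-++ˡ B) p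
desubstitute (skip a s) eq U≢[] nf with desubstitute s eq U≢[] (nf ∘ there)
... | u , (x , y , refl) , ant = u , (a ∷ x , y , refl) , ant

lemma1 : (U : Word) → Factor U → ¬ (U ≡ []) →
  ∃[ u ] ∃[ δ ] (Factor u × (δ ≡ - (+ 1) ⊎ δ ≡ + 0 ⊎ δ ≡ + 1)
    × (+ count a0 U ≡ + length u + δ) × (count a1 U ≡ count a0 u) × (count a2 U ≡ count a1 u)
    × (length U ≥ 3 → length u < length U))
lemma1 U fU U≢[] with factor⇒infix fU
... | n , x , y , eq with desubstitute (suffix-τ (τⁿ0 n) x eq) refl U≢[] (¬Has22-τⁿ0 n)
...   | u , u-infix , δ , δ∈ , shift , shrinks =
  u , δ , infix⇒factor n u-infix , δ∈ , count₀ , count₁ , count₂ , shrinks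
  where open ShiftedParikh shift
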